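{- Let $G$ be an abelian group, $k,\ell\ge1$, $\vec a\in G^k$, $\vec b\in G^\ell$ and $(\varphi,\psi)\in I_{k,\ell}$. Then $\theta(\vec a\sqcup\!\sqcup_{(\varphi,\psi)}\vec b)=\theta(\vec a)\,\overline{\sqcup\!\sqcup}_{(\varphi,\psi)}\,\theta(\vec b)$.
   Context: $G$ is written multiplicatively. For $(b_1,\dots,b_m)\in G^m$, $\theta(b_1,\dots,b_m)=(1/b_1,\,b_1/b_2,\dots,\,b_{m-1}/b_m)$. $[m]=\{1,\dots,m\}$. $I_{k,\ell}$ is the set of pairs $(\varphi,\psi)$ of order-preserving injective maps $\varphi:[k]\to[k+\ell]$, $\psi:[\ell]\to[k+\ell]$ with $\mathrm{im}\,\varphi\sqcup\mathrm{im}\,\psi=[k+\ell]$. $\vec a\sqcup\!\sqcup_{(\varphi,\psi)}\vec b\in G^{k+\ell}$ has $i$-th entry $a_j$ if $i=\varphi(j)$ and $b_j$ if $i=\psi(j)$. For $\vec w\in G^k$, $\vec z\in G^\ell$, $\vec w\,\overline{\sqcup\!\sqcup}_{(\varphi,\psi)}\vec z\in G^{k+\ell}$ has $i$-th entry: $w_j$ if $i=\varphi(j)$ and ($i=1$ or $i-1\in\mathrm{im}\,\varphi$); $z_j$ if $i=\psi(j)$ and ($i=1$ or $i-1\in\mathrm{im}\,\psi$); $\frac{w_1\cdots w_j}{z_1\cdots z_{i-j}}$ if $i=\varphi(j)$ and $i-1\in\mathrm{im}\,\psi$; $\frac{z_1\cdots z_j}{w_1\cdots w_{i-j}}$ if $i=\psi(j)$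 and $i-1\in\mathrm{im}\,\varphi$. -}

module Defs where

open import Level using (_⊔_)
open import Algebra.Bundles using (AbelianGroup)
open import Data.Nat using (ℕ; zero; suc; _+_; _∸_)
open import Data.Fin using (Fin; zero; suc; toℕ; inject₁; _<_)
open import Data.Product using (Σ; _,_; proj₁)
open import Data.Sum using (_⊎_; inj₁; inj₂)
open import Relation.Binary.PropositionalEquality using (_≡_)
open import Relation.Nullary using (¬_)

-- Elements of I_{k,m}: pairs (φ , ψ) of strictly increasing (= order-preserving
-- injective) maps φ : [k] → [k+m], ψ : [m] → [k+m] whose images partition [k+m].
-- Indices are 0-based (Fin).  The covering condition is given constructively
-- (every position lies in im φ or in im ψ, with a witness); this is equivalent
-- to the set-theoretic condition since everything is finite and decidable.
record Shuffle (k m : ℕ) : Set where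
  field
    φ : Fin k → Fin (k + m)
    ψ : Fin m → Fin (k + m)
    φ-mono : ∀ {i j} → i < j → φ i < φ j
    ψ-mono : ∀ {i j} → i < j → ψ i < ψ j
    disjoint : ∀ i j → ¬ (φ i ≡ ψ j)
    cover : ∀ (p : Fin (k + m)) → Σ (Fin k) (λ j → φ j ≡ p) ⊎ Σ (Fin m) (λ j → ψ j ≡ p)

module _ {c ℓ} (G : AbelianGroup c ℓ) where
  open AbelianGroup G

  _/_ : Carrier → Carrier → Carrier
  x / y = x ∙ y ⁻¹

  _≋_ : ∀ {n} → (Fin n → Carrier) → (Fin n → Carrier) → Set ℓ
  u ≋ v = ∀ i → u i ≈ v i

  θ : ∀ {n} → (Fin n → Carrier) → Fin n → Carrier
  θ b zero = ε / b zero
  θ b (suc i) = b (inject₁ i) / b (suc i)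

  prefix : ∀ {n} → (Fin n → Carrier) → ℕ → Carrier
  prefix {zero} w _ = ε
  prefix {suc n} w zero = ε
  prefix {suc n} w (suc r) = w zero ∙ prefix (λ i → w (suc i)) r

  -- Modified shuffle, generalised over the ambient length n (later n = k + m)
  -- so that Fin n can be split.  c tells, for each position p, whether
  -- p = φ j or p = ψ j (with the witness j).
  -- Paper position i (1-based) is p with i = toℕ p + 1; paper index j is toℕ j + 1,
  -- so i - j = toℕ p ∸ toℕ j, and w₁⋯w_j = prefix w (suc (toℕ j)).
  shuffleBarAux : ∀ {k m n} {φ : Fin k → Fin n} {ψ : Fin m → Fin n} →
    ((p : Fin n) → Σ (Fin k) (λ j → φ j ≡ p) ⊎ Σ (Fin m) (λ j → ψ j ≡ p)) →
    (Fin k → Carrier) → (Fin m → Carrier) → Fin n → Carrier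
  shuffleBarAux c w z zero with c zero
  ... | inj₁ (j , _) = w j
  ... | inj₂ (j , _) = z j
  shuffleBarAux c w z (suc q) with c (suc q) | c (inject₁ q)
  ... | inj₁ (j , _) | inj₁ _ = w j
  ... | inj₁ (j , _) | inj₂ _ = prefix w (suc (toℕ j)) / prefix z (toℕ (suc q) ∸ toℕ j)
  ... | inj₂ (j , _) | inj₂ _ = z j
  ... | inj₂ (j , _) | inj₁ _ = prefix z (suc (toℕ j)) / prefix w (toℕ (suc q) ∸ toℕ j)

  module _ {k m : ℕ} (σ : Shuffle k m) where
    open Shuffle σ

    shuffle : (Fin k → Carrier) → (Fin m → Carrier) → Fin (k + m) → Carrier
    shuffle a b p with cover p
    ... | inj₁ (j , _) = a j
    ... | inj₂ (j , _) = b j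

    shuffleBar : (Fin k → Carrier) → (Fin m → Carrier) → Fin (k + m) → Carrier
    shuffleBar = shuffleBarAux cover

-- Let r_φ(p) and r_ψ(p) count the elements of im φ and im ψ below
-- position p; since φ, ψ are increasing with complementary images,
-- r_φ(φ j) = j, r_φ(φ j + 1) = j + 1 and r_φ(p) + r_ψ(p) = p.  Hence two
-- consecutive positions coming from the same map carry consecutive indices, so
-- θ of the shuffle reproduces an entry of θ a or θ b; and if p = φ j directly
-- follows p - 1 = ψ j', then p = j + j' + 1.  In that case the quotient
-- b_{j'} / a_j is recovered from the telescoping prefix products
-- θ(a)_1 ⋯ θ(a)_j = 1 / a_j, which is the extra entry of the modified shuffle.
module Submission where

open import Defs
open import Algebra.Bundles using (AbelianGroup)
open import Data.Nat using (ℕ; _≤_)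
open import Data.Fin using (Fin)

open import Data.Nat using (zero; suc; _+_; _∸_; _<_; _<?_; z≤n; s≤s; s≤s⁻¹)
open import Data.Nat.Properties
  using (+-0-monoid; suc-injective; +-comm; +-suc; m+n∸m≡n; <⇒≤; <⇒≱; ≮⇒≥; <-irrefl; <-asym; ≤∧≢⇒<; m<n⇒m<1+n)
open import Data.Fin as Fin using (toℕ; inject₁; fromℕ<)
open import Data.Fin.Properties as Finₚ using (toℕ-injective; toℕ<n; toℕ-fromℕ<; toℕ-inject₁)
open import Data.Bool using (if_then_else_)
open import Data.Product using (_,_)
open import Data.Sum using (inj₁; inj₂)
open import Data.Empty using (⊥-elim)
open import Function using (_∘_; _⇔_; mk⇔)
open import Relation.Nullary using (does)
open import Relation.Nullary.Decidable using (does-⇔)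
open import Relation.Binary.Definitions using (tri<; tri≈; tri>)
open import Relation.Binary.PropositionalEquality
  using (_≡_; _≢_; refl; sym; trans; cong; cong₂; subst; module ≡-Reasoning)
open import Algebra.Properties.Monoid.Sum +-0-monoid using (sum; sum-cong-≗; sum-replicate-zero)
import Algebra.Properties.AbelianGroup as AbelianGroupProperties
import Relation.Binary.Reasoning.Setoid as SetoidReasoning

m+n≡o⇒o∸m≡n : ∀ {m n o} → m + n ≡ o → o ∸ m ≡ n
m+n≡o⇒o∸m≡n {m} {n} refl = m+n∸m≡n m n

≡inject₁⇒toℕ≡ : ∀ {n} {p : Fin (suc n)} {q : Fin n} → p ≡ inject₁ q → toℕ p ≡ toℕ q
≡inject₁⇒toℕ≡ {q = q} refl = toℕ-inject₁ q

countBelow : ∀ {k} → (Fin k → ℕ) → ℕ → ℕ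
countBelow f r = sum (λ i → if does (f i <? r) then 1 else 0)

countBelow-cong : ∀ {k} {f g : Fin k → ℕ} {r s} →
  (∀ i → (f i < r) ⇔ (g i < s)) → countBelow f r ≡ countBelow g s
countBelow-cong f⇔g = sum-cong-≗ (λ i → cong (if_then 1 else 0) (does-⇔ (f⇔g i) (_ <? _) (_ <? _)))

countBelow-zero : ∀ {k} (f : Fin k → ℕ) → countBelow f 0 ≡ 0
countBelow-zero {k} f = sum-replicate-zero k

countBelow-toℕ : ∀ {k t} → t ≤ k → countBelow {k} toℕ t ≡ t
countBelow-toℕ {zero} z≤n = refl
countBelow-toℕ {suc k} {zero} _ = countBelow-zero {suc k} toℕ
countBelow-toℕ {suc k} {suc t} (s≤s t≤k) = cong suc (countBelow-toℕ t≤k)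

countBelow-suc-miss : ∀ {k} {f : Fin k → ℕ} {r} → (∀ i → f i ≢ r) →
  countBelow f (suc r) ≡ countBelow f r
countBelow-suc-miss f≢r =
  countBelow-cong (λ i → mk⇔ (λ fi<1+r → ≤∧≢⇒< (s≤s⁻¹ fi<1+r) (f≢r i)) m<n⇒m<1+n)

module StrictlyIncreasing {k n} (f : Fin k → Fin n)
                          (f-mono : ∀ {i j} → i Fin.< j → f i Fin.< f j) where

  <-reflect : ∀ {i j} → f i Fin.< f j → i Fin.< j
  <-reflect {i} {j} fi<fj with Finₚ.<-cmp i j
  ... | tri< i<j _ _ = i<j
  ... | tri≈ _ refl _ = ⊥-elim (<-irrefl refl fi<fj)
  ... | tri> _ _ j<i = ⊥-elim (<-asym fi<fj (f-mono j<i))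

  ≤-reflect : ∀ {i j} → f i Fin.≤ f j → i Fin.≤ j
  ≤-reflect fi≤fj = ≮⇒≥ (λ j<i → <⇒≱ (f-mono j<i) fi≤fj)

  ≤-preserve : ∀ {i j} → i Fin.≤ j → f i Fin.≤ f j
  ≤-preserve i≤j = ≮⇒≥ (λ fj<fi → <⇒≱ (<-reflect fj<fi) i≤j)

  rank : ℕ → ℕ
  rank = countBelow (toℕ ∘ f)

  rank-at : ∀ {j r} → toℕ (f j) ≡ r → rank r ≡ toℕ j
  rank-at {j} refl = trans (countBelow-cong {g = toℕ} (λ _ → mk⇔ <-reflect f-mono))
                           (countBelow-toℕ (<⇒≤ (toℕ<n j)))

  rank-suc-at : ∀ {j r} → toℕ (f j) ≡ r → rank (suc r) ≡ suc (toℕ j)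
  rank-suc-at {j} refl =
    trans (countBelow-cong {g = toℕ} (λ _ → mk⇔ (s≤s ∘ ≤-reflect ∘ s≤s⁻¹) (s≤s ∘ ≤-preserve ∘ s≤s⁻¹)))
          (countBelow-toℕ (toℕ<n j))

  rank-suc-hit : ∀ {j r} → toℕ (f j) ≡ r → rank (suc r) ≡ suc (rank r)
  rank-suc-hit fj≡r = trans (rank-suc-at fj≡r) (cong suc (sym (rank-at fj≡r)))

  index-zero : ∀ {j} → toℕ (f j) ≡ 0 → toℕ j ≡ 0
  index-zero {j} fj≡0 = trans (sym (rank-at fj≡0)) (countBelow-zero (toℕ ∘ f))

  index-suc : ∀ {j j′ r} → toℕ (f j) ≡ suc r → toℕ (f j′) ≡ r → toℕ j ≡ suc (toℕ j′)
  index-suc fj≡1+r fj′≡r = trans (sym (rank-at fj≡1+r)) (rank-suc-at fj′≡r)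

module ShuffleRanks {k m} (σ : Shuffle k m) where
  open Shuffle σ
  module Φ = StrictlyIncreasing φ φ-mono
  module Ψ = StrictlyIncreasing ψ ψ-mono
  open ≡-Reasoning

  rank-φ+rank-ψ : ∀ r → r ≤ k + m → Φ.rank r + Ψ.rank r ≡ r
  rank-φ+rank-ψ zero _ = cong₂ _+_ (countBelow-zero (toℕ ∘ φ)) (countBelow-zero (toℕ ∘ ψ))
  rank-φ+rank-ψ (suc r) r<k+m with cover (fromℕ< r<k+m)
  ... | inj₁ (j , φj≡p) = begin
    Φ.rank (suc r) + Ψ.rank (suc r)
      ≡⟨ cong₂ _+_ (Φ.rank-suc-hit φj≡r) (countBelow-suc-miss ψ≢r) ⟩
    suc (Φ.rank r + Ψ.rank r)
      ≡⟨ cong suc (rank-φ+rank-ψ r (<⇒≤ r<k+m)) ⟩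
    suc r ∎
    where
    φj≡r = trans (cong toℕ φj≡p) (toℕ-fromℕ< r<k+m)
    ψ≢r : ∀ i → toℕ (ψ i) ≢ r
    ψ≢r i ψi≡r = disjoint j i (toℕ-injective (trans φj≡r (sym ψi≡r)))
  ... | inj₂ (j , ψj≡p) = begin
    Φ.rank (suc r) + Ψ.rank (suc r)
      ≡⟨ cong₂ _+_ (countBelow-suc-miss φ≢r) (Ψ.rank-suc-hit ψj≡r) ⟩
    Φ.rank r + suc (Ψ.rank r)
      ≡⟨ +-suc (Φ.rank r) (Ψ.rank r) ⟩
    suc (Φ.rank r + Ψ.rank r)
      ≡⟨ cong suc (rank-φ+rank-ψ r (<⇒≤ r<k+m)) ⟩
    suc r ∎
    where
    ψj≡r = trans (cong toℕ ψj≡p) (toℕ-fromℕ< r<k+m)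
    φ≢r : ∀ i → toℕ (φ i) ≢ r
    φ≢r i φi≡r = disjoint i j (toℕ-injective (trans φi≡r (sym ψj≡r)))

  φ-after-ψ : ∀ {j j′ r} → toℕ (φ j) ≡ suc r → toℕ (ψ j′) ≡ r → suc r ∸ toℕ j ≡ suc (toℕ j′)
  φ-after-ψ {j} {j′} {r} φj≡1+r ψj′≡r = m+n≡o⇒o∸m≡n (begin
    toℕ j + suc (toℕ j′)
      ≡⟨ sym (cong₂ _+_ (Φ.rank-at φj≡1+r) (Ψ.rank-suc-at ψj′≡r)) ⟩
    Φ.rank (suc r) + Ψ.rank (suc r)
      ≡⟨ rank-φ+rank-ψ (suc r) (subst (_≤ k + m) φj≡1+r (<⇒≤ (toℕ<n (φ j)))) ⟩
    suc r ∎)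

  ψ-after-φ : ∀ {j j′ r} → toℕ (ψ j) ≡ suc r → toℕ (φ j′) ≡ r → suc r ∸ toℕ j ≡ suc (toℕ j′)
  ψ-after-φ {j} {j′} {r} ψj≡1+r φj′≡r = m+n≡o⇒o∸m≡n (begin
    toℕ j + suc (toℕ j′)
      ≡⟨ +-comm (toℕ j) (suc (toℕ j′)) ⟩
    suc (toℕ j′) + toℕ j
      ≡⟨ sym (cong₂ _+_ (Φ.rank-suc-at φj′≡r) (Ψ.rank-at ψj≡1+r)) ⟩
    Φ.rank (suc r) + Ψ.rank (suc r)
      ≡⟨ rank-φ+rank-ψ (suc r) (subst (_≤ k + m) ψj≡1+r (<⇒≤ (toℕ<n (ψ j)))) ⟩
    suc r ∎)

module _ {c ℓ} (G : AbelianGroup c ℓ) where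
  open AbelianGroup G renaming (refl to ≈-refl; trans to ≈-trans)
  open AbelianGroupProperties G using (⁻¹-involutive; //-cong₂)
  open SetoidReasoning setoid

  -- x - y unfolds to x ∙ y ⁻¹, i.e. to x / y of Defs.

  x-w∙w-y≈x-y : ∀ x w y → (x - w) ∙ (w - y) ≈ x - y
  x-w∙w-y≈x-y x w y = begin
    (x ∙ w ⁻¹) ∙ (w ∙ y ⁻¹) ≈⟨ assoc x (w ⁻¹) (w ∙ y ⁻¹) ⟩
    x ∙ (w ⁻¹ ∙ (w ∙ y ⁻¹)) ≈⟨ ∙-congˡ (assoc (w ⁻¹) w (y ⁻¹)) ⟨
    x ∙ ((w ⁻¹ ∙ w) ∙ y ⁻¹) ≈⟨ ∙-congˡ (∙-congʳ (inverseˡ w)) ⟩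
    x ∙ (ε ∙ y ⁻¹)          ≈⟨ ∙-congˡ (identityˡ (y ⁻¹)) ⟩
    x ∙ y ⁻¹                ∎

  [ε-x]-[ε-y]≈y-x : ∀ x y → (ε - x) - (ε - y) ≈ y - x
  [ε-x]-[ε-y]≈y-x x y = begin
    (ε ∙ x ⁻¹) ∙ (ε ∙ y ⁻¹) ⁻¹ ≈⟨ ∙-cong (identityˡ (x ⁻¹)) (⁻¹-cong (identityˡ (y ⁻¹))) ⟩
    x ⁻¹ ∙ y ⁻¹ ⁻¹             ≈⟨ ∙-congˡ (⁻¹-involutive y) ⟩
    x ⁻¹ ∙ y                   ≈⟨ comm (x ⁻¹) y ⟩
    y ∙ x ⁻¹                   ∎

  prefix-cong : ∀ {n} {u v : Fin n → Carrier} → _≋_ G u v → ∀ r → prefix G u r ≈ prefix G v r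
  prefix-cong {zero} u≋v r = ≈-refl
  prefix-cong {suc n} u≋v zero = ≈-refl
  prefix-cong {suc n} u≋v (suc r) = ∙-cong (u≋v Fin.zero) (prefix-cong (u≋v ∘ Fin.suc) r)

  prefix-zero : ∀ {n} (u : Fin n → Carrier) → prefix G u 0 ≈ ε
  prefix-zero {zero} u = ≈-refl
  prefix-zero {suc n} u = ≈-refl

  -- θ with x in place of the unit; unlike θ, this shape is preserved by taking tails.
  θ-from : ∀ {n} → Carrier → (Fin n → Carrier) → Fin n → Carrier
  θ-from x w Fin.zero = x - w Fin.zero
  θ-from x w (Fin.suc i) = w (inject₁ i) - w (Fin.suc i)

  prefix-θ-from : ∀ {n} x (w : Fin n → Carrier) j → prefix G (θ-from x w) (suc (toℕ j)) ≈ x - w j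
  prefix-θ-from {suc n} x w Fin.zero =
    ≈-trans (∙-congˡ (prefix-zero (θ-from x w ∘ Fin.suc))) (identityʳ (x - w Fin.zero))
  prefix-θ-from {suc n} x w (Fin.suc j) = begin
    (x - w₀) ∙ prefix G (θ-from x w ∘ Fin.suc) (suc (toℕ j))
      ≈⟨ ∙-congˡ (prefix-cong tail-θ-from (suc (toℕ j))) ⟩
    (x - w₀) ∙ prefix G (θ-from w₀ (w ∘ Fin.suc)) (suc (toℕ j))
      ≈⟨ ∙-congˡ (prefix-θ-from w₀ (w ∘ Fin.suc) j) ⟩
    (x - w₀) ∙ (w₀ - w (Fin.suc j))
      ≈⟨ x-w∙w-y≈x-y x w₀ (w (Fin.suc j)) ⟩
    x - w (Fin.suc j) ∎
    where
    w₀ = w Fin.zero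
    tail-θ-from : _≋_ G (θ-from x w ∘ Fin.suc) (θ-from w₀ (w ∘ Fin.suc))
    tail-θ-from Fin.zero = ≈-refl
    tail-θ-from (Fin.suc i) = ≈-refl

  prefix-θ : ∀ {n} (w : Fin n → Carrier) j → prefix G (θ G w) (suc (toℕ j)) ≈ ε - w j
  prefix-θ w j = ≈-trans (prefix-cong θ≋θ-from (suc (toℕ j))) (prefix-θ-from ε w j)
    where
    θ≋θ-from : _≋_ G (θ G w) (θ-from ε w)
    θ≋θ-from Fin.zero = ≈-refl
    θ≋θ-from (Fin.suc i) = ≈-refl

  θ-initial : ∀ {n} (w : Fin n → Carrier) {j} → toℕ j ≡ 0 → ε - w j ≈ θ G w j
  θ-initial w {Fin.zero} _ = ≈-refl

  θ-consecutive : ∀ {n} (w : Fin n → Carrier) {j j′} → toℕ j ≡ suc (toℕ j′) → w j′ - w j ≈ θ G w j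
  θ-consecutive w {Fin.suc j} {j′} j≡1+j′
    with refl ← toℕ-injective {i = inject₁ j} {j = j′} (trans (toℕ-inject₁ j) (suc-injective j≡1+j′))
    = ≈-refl

  θ-cross : ∀ {k m} (a : Fin k → Carrier) (b : Fin m → Carrier) {j j′ r} → r ≡ suc (toℕ j′) →
    b j′ - a j ≈ prefix G (θ G a) (suc (toℕ j)) - prefix G (θ G b) r
  θ-cross a b {j} {j′} refl = begin
    b j′ - a j               ≈⟨ [ε-x]-[ε-y]≈y-x (a j) (b j′) ⟨
    (ε - a j) - (ε - b j′)   ≈⟨ //-cong₂ (prefix-θ a j) (prefix-θ b j′) ⟨
    prefix G (θ G a) (suc (toℕ j)) - prefix G (θ G b) (suc (toℕ j′)) ∎

lemma4p1 : ∀ {c ℓ} (G : AbelianGroup c ℓ) (k m : ℕ) → 1 ≤ k → 1 ≤ m →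
    (a : Fin k → AbelianGroup.Carrier G) (b : Fin m → AbelianGroup.Carrier G) (σ : Shuffle k m) →
    _≋_ G (θ G (shuffle G σ a b)) (shuffleBar G σ (θ G a) (θ G b))
lemma4p1 G (suc k) m (s≤s z≤n) _ a b σ = pointwise
  where
  open Shuffle σ
  open ShuffleRanks σ
  pointwise : _≋_ G (θ G (shuffle G σ a b)) (shuffleBar G σ (θ G a) (θ G b))
  pointwise Fin.zero with cover Fin.zero
  ... | inj₁ (j , e) = θ-initial G a (Φ.index-zero (cong toℕ e))
  ... | inj₂ (j , e) = θ-initial G b (Ψ.index-zero (cong toℕ e))
  pointwise (Fin.suc q) with cover (Fin.suc q) | cover (inject₁ q)
  ... | inj₁ (j , e) | inj₁ (j′ , e′) = θ-consecutive G a (Φ.index-suc (cong toℕ e) (≡inject₁⇒toℕ≡ e′))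
  ... | inj₂ (j , e) | inj₂ (j′ , e′) = θ-consecutive G b (Ψ.index-suc (cong toℕ e) (≡inject₁⇒toℕ≡ e′))
  ... | inj₁ (j , e) | inj₂ (j′ , e′) = θ-cross G a b (φ-after-ψ (cong toℕ e) (≡inject₁⇒toℕ≡ e′))
  ... | inj₂ (j , e) | inj₁ (j′ , e′) = θ-cross G b a (ψ-after-φ (cong toℕ e) (≡inject₁⇒toℕ≡ e′))
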